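{- Let $\sigma$ and $\tau$ be the substitutions on $\{0,1\}$ defined by $\sigma(0)=01$, $\sigma(1)=100110$ and $\tau(0)=011001$, $\tau(1)=10$, and let $u=\sigma^\infty(0)$ be the fixed point of $\sigma$ starting with $0$. Let $\mathrm{Stab}(u)$ be the set of substitutions $\varphi$ on $\{0,1\}$ with $\varphi(u)=u$. Then $$\mathrm{Stab}(u)=\{\sigma^i,\ \tau^j,\ \sigma\circ\tau^k,\ \tau\circ\sigma^\ell \mid i,j,k,\ell\in\mathbb{N}\}.$$
   Context: A substitution on $\{0,1\}$ is a non-erasing monoid morphism $\{0,1\}^*\to\{0,1\}^*$, acting letter by letter on infinite words. $\sigma^\infty(0)$ denotes the unique infinite word having all $\sigma^n(0)$ as prefixes. $\mathbb{N}$ includes $0$, and $\sigma^0$ is the identity. -}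

module Defs where

open import Data.Nat using (ℕ; zero; suc)
open import Data.List using (List; []; _∷_; upTo; map; concatMap)
open import Data.List.NonEmpty using (List⁺; _∷_; [_]; toList)
import Data.List.NonEmpty as L⁺
open import Data.Product using (Σ; _×_; _,_; ∃-syntax)
open import Data.Sum using (_⊎_)
open import Relation.Binary.PropositionalEquality using (_≡_)

data Bit : Set where
  b0 b1 : Bit

Word : Set
Word = ℕ → Bit

-- A substitution (non-erasing morphism {0,1}* → {0,1}*) is determined by
-- the (nonempty) images of the two letters.
Subst : Set
Subst = Bit → List⁺ Bit

image : Subst → List Bit → List Bit
image φ w = concatMap (λ a → toList (φ a)) w

_∘ˢ_ : Subst → Subst → Subst
(φ ∘ˢ ψ) a = L⁺.concatMap φ (ψ a)

_^ˢ_ : Subst → ℕ → Subst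
φ ^ˢ zero = [_]
φ ^ˢ suc n = φ ∘ˢ (φ ^ˢ n)

nth : {A : Set} → List A → ℕ → A → A
nth [] n d = d
nth (x ∷ xs) zero d = x
nth (x ∷ xs) (suc n) d = nth xs n d

-- Action of a substitution on an infinite word (letter by letter):
-- since φ is non-erasing, the first n+1 letters of φ(w) lie in
-- φ(w 0 ⋯ w n).
apply : Subst → Word → Word
apply φ w n = nth (image φ (map w (upTo (suc n)))) n b0

_≈ˢ_ : Subst → Subst → Set
φ ≈ˢ ψ = ∀ a → φ a ≡ ψ a

σ : Subst
σ b0 = b0 ∷ b1 ∷ []
σ b1 = b1 ∷ b0 ∷ b0 ∷ b1 ∷ b1 ∷ b0 ∷ []

τ : Subst
τ b0 = b0 ∷ b1 ∷ b1 ∷ b0 ∷ b0 ∷ b1 ∷ []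
τ b1 = b1 ∷ b0 ∷ []

-- u = σ^∞(0): the n-th letter of u is the n-th letter of σ^(n+1)(0)
-- (which has length ≥ 2^(n+1) > n, and σ^k(0) is a prefix of σ^(k+1)(0)).
u : Word
u n = nth (toList ((σ ^ˢ suc n) b0)) n b0

Stab : Subst → Set
Stab φ = ∀ n → apply φ u n ≡ u n

InFamily : Subst → Set
InFamily φ =
  (∃[ i ] φ ≈ˢ (σ ^ˢ i)) ⊎
  (∃[ j ] φ ≈ˢ (τ ^ˢ j)) ⊎
  (∃[ k ] φ ≈ˢ (σ ∘ˢ (τ ^ˢ k))) ⊎
  (∃[ l ] φ ≈ˢ (τ ∘ˢ (σ ^ˢ l)))

{-# OPTIONS --safe #-}
module Submission where

open import Defs
open import Data.Empty using (⊥-elim)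
open import Data.List.Base using (List; []; _∷_; _++_; length; map; upTo; applyUpTo)
open import Data.List.Effectful using (module MonadProperties)
-- Renamed: an overloaded _∷_ in the variable lists given to solve makes checking blow up.
open import Data.List.NonEmpty.Base using (List⁺; toList; [_]) renaming (_∷_ to _∷⁺_)
open import Data.List.NonEmpty.Properties using (toList->>=)
open import Data.List.Properties using (length-++; ++-assoc; ++-identityʳ; concatMap-++; concatMap-cong; concatMap-pure; map-upTo; ∷-injective)
open import Data.Nat.Base using (ℕ; zero; suc; _+_; _*_; _^_; _≤_; _<_; z≤n; s≤s; s≤s⁻¹; ⌊_/2⌋)
open import Data.Nat.Induction using (<-rec)
open import Data.Nat.Properties
  using (≤-trans; ≤-refl; ≤-reflexive; <⇒≤; n≤1+n; n<1+n; m<n⇒m<1+n; m≤m+n; m≤n+m; n≮0; +-assoc; +-identityʳ; +-comm; +-suc;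
         +-mono-≤; +-monoˡ-≤; +-monoʳ-≤; +-mono-<; +-monoʳ-<; *-identityʳ; *-distribˡ-+; *-distribʳ-+;
         n≡⌊n+n/2⌋; n≡⌈n+n/2⌉; ⌊n/2⌋≤n; ⌊n/2⌋<n; +-commutativeSemigroup; module ≤-Reasoning)
open import Algebra.Properties.CommutativeSemigroup +-commutativeSemigroup using (x∙yz≈y∙xz)
open import Data.Nat.Tactic.RingSolver using (solve; solve-∀)
open import Data.Product.Base using (_×_; _,_; proj₁; proj₂; ∃-syntax; ∃₂)
open import Data.Sum.Base using (_⊎_; inj₁; inj₂)
open import Function.Base using (id; _∘_)
open import Relation.Binary.PropositionalEquality hiding ([_])
open import Relation.Nullary using (¬_)

-- Write μ for the Thue–Morse morphism 0 ↦ 01, 1 ↦ 10 and δ for a ↦ aa. The fixed point u of σ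
-- is F = μ(H), where H = μ(D) and D = δ(H). Both σ and τ satisfy ψ ∘ μ = μ ∘ μ ∘ δ, so they map
-- prefixes of F = μμδ(H) to prefixes of F, and so do all their products: the family fixes u.
-- Conversely let φ(u) = u with x = φ(0), y = φ(1). As u begins with 01100, it begins with xyyxx.
-- Parity arguments in μ- and δ-images force |x| and |y| to be even unless (|x|,|y|) is (1,1)
-- in F or (1,3), (3,1) in H; halving and passing from F to H to D to H ... then leaves only
-- (|x|,|y|) = (1,1), (2·4ᵏ, 6·4ᵏ) or (6·4ᵏ, 2·4ᵏ), the lengths of σ⁰, σᵏ⁺¹ and τᵏ⁺¹.
-- Since x and y are the factors of u of these lengths at positions 0 and |x|, φ is one of them.

bnot : Bit → Bit
bnot b0 = b1
bnot b1 = b0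

bnot-involutive : ∀ a → bnot (bnot a) ≡ a
bnot-involutive b0 = refl
bnot-involutive b1 = refl

bnot-injective : ∀ {a b} → bnot a ≡ bnot b → a ≡ b
bnot-injective {a} {b} e = trans (sym (bnot-involutive a)) (trans (cong bnot e) (bnot-involutive b))

bnot-≢ : ∀ a → bnot a ≢ a
bnot-≢ b0 ()
bnot-≢ b1 ()

b1≢b0 : b1 ≢ b0
b1≢b0 ()

_⊕_ : Bit → Bit → Bit
b0 ⊕ a = a
b1 ⊕ a = bnot a

parity : ℕ → Bit
parity zero          = b0
parity (suc zero)    = b1
parity (suc (suc n)) = parity n

parity-even : ∀ m → parity (m + m) ≡ b0
parity-even zero    = refl
parity-even (suc m) rewrite +-suc m m = parity-even m

parity-odd : ∀ m → parity (suc (m + m)) ≡ b1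
parity-odd zero    = refl
parity-odd (suc m) rewrite +-suc m m = parity-odd m

⌊2m/2⌋≡m : ∀ m → ⌊ m + m /2⌋ ≡ m
⌊2m/2⌋≡m m = sym (n≡⌊n+n/2⌋ m)

⌊2m+1/2⌋≡m : ∀ m → ⌊ suc (m + m) /2⌋ ≡ m
⌊2m+1/2⌋≡m m = sym (n≡⌈n+n/2⌉ m)

data EvenOdd : ℕ → Set where
  even : ∀ m → EvenOdd (m + m)
  odd  : ∀ m → EvenOdd (suc (m + m))

evenOdd : ∀ n → EvenOdd n
evenOdd zero = even 0
evenOdd (suc n) with evenOdd n
... | even m = odd m
... | odd m  = subst EvenOdd (cong suc (+-suc m m)) (even (suc m))

-- The words F, H and D

-- W is the image of V under the 2-uniform morphism a ↦ a (g a): μ for g = bnot, δ for g = id.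
record Image₂ (g : Bit → Bit) (V W : Word) : Set where
  field
    on-even : ∀ m → W (m + m) ≡ V m
    on-odd  : ∀ m → W (suc (m + m)) ≡ g (V m)

-- H(n) = parity(n) ⊕ H(⌊n/4⌋), computed with fuel k, which is enough as soon as n ≤ k.
Hᶠ : ℕ → ℕ → Bit
Hᶠ zero    n = b0
Hᶠ (suc k) n = parity n ⊕ Hᶠ k ⌊ ⌊ n /2⌋ /2⌋

H : Word
H n = Hᶠ n n

D : Word
D m = H ⌊ m /2⌋

F : Word
F n = parity n ⊕ H ⌊ n /2⌋

Hᶠ-zero : ∀ k → Hᶠ k 0 ≡ b0
Hᶠ-zero zero    = refl
Hᶠ-zero (suc k) = Hᶠ-zero k

⌊n/4⌋≤pred : ∀ {n k} → n ≤ suc k → ⌊ ⌊ n /2⌋ /2⌋ ≤ k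
⌊n/4⌋≤pred {zero}  _           = z≤n
⌊n/4⌋≤pred {suc n} (s≤s n≤k) = ≤-trans (⌊n/2⌋≤n ⌊ suc n /2⌋) (≤-trans (s≤s⁻¹ (⌊n/2⌋<n n)) n≤k)

Hᶠ-fuel-irrelevant : ∀ {k k′ n} → n ≤ k → n ≤ k′ → Hᶠ k n ≡ Hᶠ k′ n
Hᶠ-fuel-irrelevant {zero}  {k′}     z≤n _   = sym (Hᶠ-zero k′)
Hᶠ-fuel-irrelevant {suc k} {zero}   _   z≤n = Hᶠ-zero (suc k)
Hᶠ-fuel-irrelevant {suc k} {suc k′} {n} n≤k n≤k′ =
  cong (parity n ⊕_) (Hᶠ-fuel-irrelevant (⌊n/4⌋≤pred n≤k) (⌊n/4⌋≤pred n≤k′))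

H-unfold : ∀ n → H n ≡ parity n ⊕ H ⌊ ⌊ n /2⌋ /2⌋
H-unfold n = trans (Hᶠ-fuel-irrelevant ≤-refl (n≤1+n n))
                   (cong (parity n ⊕_) (Hᶠ-fuel-irrelevant (⌊n/4⌋≤pred (n≤1+n n)) ≤-refl))

F-image : Image₂ bnot H F
F-image = record
  { on-even = λ m → cong₂ _⊕_ (parity-even m) (cong H (⌊2m/2⌋≡m m))
  ; on-odd  = λ m → cong₂ _⊕_ (parity-odd m) (cong H (⌊2m+1/2⌋≡m m))
  }

H-image : Image₂ bnot D H
H-image = record
  { on-even = λ m → trans (H-unfold (m + m)) (cong₂ _⊕_ (parity-even m) (cong (λ k → H ⌊ k /2⌋) (⌊2m/2⌋≡m m)))
  ; on-odd  = λ m → trans (H-unfold (suc (m + m))) (cong₂ _⊕_ (parity-odd m) (cong (λ k → H ⌊ k /2⌋) (⌊2m+1/2⌋≡m m)))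
  }

D-image : Image₂ id H D
D-image = record
  { on-even = λ m → cong H (⌊2m/2⌋≡m m)
  ; on-odd  = λ m → cong H (⌊2m+1/2⌋≡m m)
  }

record SameFactor (W : Word) (s t n : ℕ) : Set where
  constructor sameFactor
  field at : ∀ j → j < n → W (s + j) ≡ W (t + j)

SameFactor-letter : ∀ {W s t n} → SameFactor W s t n → ∀ j → j < n → (p q : ℕ) → s + j ≡ p → t + j ≡ q → W p ≡ W q
SameFactor-letter sf j j<n p q refl refl = SameFactor.at sf j j<n

SameFactor-take : ∀ {W s t n} k → k ≤ n → SameFactor W s t n → SameFactor W s t k
SameFactor-take k k≤n sf = sameFactor λ j j<k → SameFactor.at sf j (≤-trans j<k k≤n)

SameFactor-drop : ∀ {W s t n} k → SameFactor W s t n → ∀ i → i + k ≤ n → SameFactor W (s + i) (t + i) k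
SameFactor-drop {s = s} {t} k sf i i+k≤n = sameFactor λ j j<k →
  SameFactor-letter sf (i + j) (≤-trans (+-monoʳ-< i j<k) i+k≤n) _ _ (sym (+-assoc s i j)) (sym (+-assoc t i j))

SameFactor-descend : ∀ {g V W s₂ t₂ n} → Image₂ g V W → SameFactor W s₂ t₂ (n + n) →
                     ∀ s t → s₂ ≡ s + s → t₂ ≡ t + t → SameFactor V s t n
SameFactor-descend {V = V} {W} img sf s t refl refl = sameFactor λ j j<n → begin
  V (s + j)               ≡⟨ Image₂.on-even img (s + j) ⟨
  W ((s + j) + (s + j))   ≡⟨ SameFactor-letter sf (j + j) (+-mono-< j<n j<n) ((s + j) + (s + j)) ((t + j) + (t + j))
                                                (solve (s ∷ j ∷ [])) (solve (t ∷ j ∷ [])) ⟩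
  W ((t + j) + (t + j))   ≡⟨ Image₂.on-even img (t + j) ⟩
  V (t + j)               ∎
  where open ≡-Reasoning

-- W begins with x y y x x, where x and y are words of lengths P and Q.
record StartsXYYXX (W : Word) (P Q : ℕ) : Set where
  field
    yy : SameFactor W (P + Q) P Q
    x₂ : SameFactor W (P + Q + Q) 0 P
    x₃ : SameFactor W (P + Q + Q + P) 0 P

open StartsXYYXX

StartsXYYXX-descend : ∀ {g V W} → Image₂ g V W → ∀ a b → StartsXYYXX W (a + a) (b + b) → StartsXYYXX V a b
StartsXYYXX-descend img a b xyyxx = record
  { yy = SameFactor-descend img (yy xyyxx) (a + b) a (solve (a ∷ b ∷ [])) refl
  ; x₂ = SameFactor-descend img (x₂ xyyxx) (a + b + b) 0 (solve (a ∷ b ∷ [])) refl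
  ; x₃ = SameFactor-descend img (x₃ xyyxx) (a + b + b + a) 0 (solve (a ∷ b ∷ [])) refl
  }

-- Parity arguments in 2-uniform images

image₂-pair : ∀ {g V W s t} → Image₂ g V W → SameFactor W s t 2 → ∀ m → s ≡ m + m → W (suc t) ≡ g (W t)
image₂-pair {g} {V} {W} {s} {t} img sf m s≡2m = begin
  W (suc t)         ≡⟨ SameFactor-letter sf 1 (s≤s (s≤s z≤n)) _ _ (trans (+-comm s 1) (cong suc s≡2m)) (+-comm t 1) ⟨
  W (suc (m + m))   ≡⟨ Image₂.on-odd img m ⟩
  g (V m)           ≡⟨ cong g (Image₂.on-even img m) ⟨
  g (W (m + m))     ≡⟨ cong g (SameFactor-letter sf 0 (s≤s z≤n) _ _ (trans (+-identityʳ s) s≡2m) (+-identityʳ t)) ⟩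
  g (W t)           ∎
  where open ≡-Reasoning

constant-run : ∀ (f : ℕ → Bit) n → (∀ i → i < n → f (suc i) ≡ f i) → f n ≡ f 0
constant-run f zero    step = refl
constant-run f (suc n) step = trans (step n (n<1+n n)) (constant-run f n (λ i i<n → step i (m<n⇒m<1+n i<n)))

module _ {V W : Word} (img : Image₂ bnot V W) where
  open Image₂ img

  image₂-bnot-pair-distinct : ∀ m → W (m + m) ≢ W (suc (m + m))
  image₂-bnot-pair-distinct m e = bnot-≢ (V m) (trans (sym (on-odd m)) (trans (sym e) (on-even m)))

  image₂-bnot-no-aaa : ∀ n → W n ≡ W (suc n) → W (suc n) ≢ W (suc (suc n))
  image₂-bnot-no-aaa n e₁ e₂ with evenOdd n
  ... | even m = image₂-bnot-pair-distinct m e₁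
  ... | odd m  = image₂-bnot-pair-distinct (suc m) (subst₂ (λ i j → W i ≡ W j) 2m+2≡ (cong suc 2m+2≡) e₂)
    where 2m+2≡ = cong suc (sym (+-suc m m))

  -- The two copies of y start at positions of different parity; comparing them shows that V is
  -- constant on [a + b, a + 2b] and yet V (a + 2b) ≠ V (a + b).
  image₂-bnot-no-odd-square-at-even : ∀ a b → ¬ SameFactor W ((a + a) + suc (b + b)) (a + a) (suc (b + b))
  image₂-bnot-no-odd-square-at-even a b sf = bnot-≢ (V (a + b)) (begin
    bnot (V (a + b))       ≡⟨ cong (bnot ∘ V) (+-identityʳ (a + b)) ⟨
    bnot (V (a + b + 0))   ≡⟨ cong bnot (constant-run (λ i → V (a + b + i)) b climb) ⟨
    bnot (V (a + b + b))   ≡⟨ odd-letters b ≤-refl ⟩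
    V (a + b)              ∎)
    where
    open ≡-Reasoning
    odd-letters : ∀ i → i ≤ b → bnot (V (a + b + i)) ≡ V (a + i)
    odd-letters i i≤b = begin
      bnot (V (a + b + i))                  ≡⟨ on-odd (a + b + i) ⟨
      W (suc ((a + b + i) + (a + b + i)))   ≡⟨ SameFactor-letter sf (i + i) (s≤s (+-mono-≤ i≤b i≤b))
                                                 (suc ((a + b + i) + (a + b + i))) ((a + i) + (a + i))
                                                 (solve (a ∷ b ∷ i ∷ [])) (solve (a ∷ i ∷ [])) ⟩
      W ((a + i) + (a + i))                 ≡⟨ on-even (a + i) ⟩
      V (a + i)                             ∎
    even-letters : ∀ i → i < b → V (a + b + suc i) ≡ bnot (V (a + i))
    even-letters i i<b = begin
      V (a + b + suc i)                       ≡⟨ on-even (a + b + suc i) ⟨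
      W ((a + b + suc i) + (a + b + suc i))   ≡⟨ SameFactor-letter sf (suc (i + i)) (s≤s (+-mono-< i<b i<b))
                                                   ((a + b + suc i) + (a + b + suc i)) (suc ((a + i) + (a + i)))
                                                   (solve (a ∷ b ∷ i ∷ [])) (solve (a ∷ i ∷ [])) ⟩
      W (suc ((a + i) + (a + i)))             ≡⟨ on-odd (a + i) ⟩
      bnot (V (a + i))                        ∎
    climb : ∀ i → i < b → V (a + b + suc i) ≡ V (a + b + i)
    climb i i<b = trans (even-letters i i<b) (bnot-injective (trans (bnot-involutive _) (sym (odd-letters i (<⇒≤ i<b)))))

  image₂-bnot-xyyxx-odd-even : ∀ p q → StartsXYYXX W (suc (p + p)) (suc q + suc q) → bnot (V p) ≡ V 0
  image₂-bnot-xyyxx-odd-even p q xyyxx = begin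
    bnot (V p)                     ≡⟨ cong bnot (trans y-end y-start) ⟨
    bnot (V (p + suc q + suc q))   ≡⟨ on-odd (p + suc q + suc q) ⟨
    W (suc ((p + suc q + suc q) + (p + suc q + suc q)))
      ≡⟨ SameFactor-letter (x₂ xyyxx) 0 (s≤s z≤n) (suc ((p + suc q + suc q) + (p + suc q + suc q))) 0 (solve (p ∷ q ∷ [])) refl ⟩
    W 0                            ≡⟨ on-even 0 ⟩
    V 0                            ∎
    where
    open ≡-Reasoning
    y-start : V (p + suc q) ≡ V p
    y-start = bnot-injective (begin
      bnot (V (p + suc q))                  ≡⟨ on-odd (p + suc q) ⟨
      W (suc ((p + suc q) + (p + suc q)))
        ≡⟨ SameFactor-letter (yy xyyxx) 0 (s≤s z≤n) (suc ((p + suc q) + (p + suc q))) (suc (p + p))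
                             (solve (p ∷ q ∷ [])) (solve (p ∷ [])) ⟩
      W (suc (p + p))                       ≡⟨ on-odd p ⟩
      bnot (V p)                            ∎)
    y-end : V (p + suc q + suc q) ≡ V (p + suc q)
    y-end = begin
      V (p + suc q + suc q)                           ≡⟨ on-even (p + suc q + suc q) ⟨
      W ((p + suc q + suc q) + (p + suc q + suc q))
        ≡⟨ SameFactor-letter (yy xyyxx) (suc (q + q)) (s≤s (≤-reflexive (sym (+-suc q q))))
                             ((p + suc q + suc q) + (p + suc q + suc q)) ((p + suc q) + (p + suc q))
                             (solve (p ∷ q ∷ [])) (solve (p ∷ q ∷ [])) ⟩
      W ((p + suc q) + (p + suc q))                   ≡⟨ on-even (p + suc q) ⟩
      V (p + suc q)                                   ∎

  image₂-bnot-prefix-at-odd : ∀ m → SameFactor W (suc (m + m)) 0 5 → V 2 ≡ V 0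
  image₂-bnot-prefix-at-odd m sf = trans (step 1 (s≤s (s≤s (s≤s (s≤s (s≤s z≤n)))))) (step 0 (s≤s (s≤s (s≤s z≤n))))
    where
    open ≡-Reasoning
    step : ∀ k → suc (suc (k + k)) < 5 → V (suc k) ≡ V k
    step k lt = begin
      V (suc k)                             ≡⟨ on-even (suc k) ⟨
      W (suc k + suc k)
        ≡⟨ SameFactor-letter sf (suc (suc (k + k))) lt (suc (suc (m + k) + suc (m + k))) (suc k + suc k)
                             (solve (m ∷ k ∷ [])) (solve (k ∷ [])) ⟨
      W (suc (suc (m + k) + suc (m + k)))   ≡⟨ on-odd (suc (m + k)) ⟩
      bnot (V (suc (m + k)))                ≡⟨ cong bnot (on-even (suc (m + k))) ⟨
      bnot (W (suc (m + k) + suc (m + k)))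
        ≡⟨ cong bnot (SameFactor-letter sf (suc (k + k)) (<⇒≤ lt) (suc (m + k) + suc (m + k)) (suc (k + k))
                                        (solve (m ∷ k ∷ [])) refl) ⟩
      bnot (W (suc (k + k)))                ≡⟨ cong bnot (on-odd k) ⟩
      bnot (bnot (V k))                     ≡⟨ bnot-involutive (V k) ⟩
      V k                                   ∎

image₂-id-copy-at-odd : ∀ {V W p q} → Image₂ id V W → SameFactor W p q 2 → ∀ s t → p ≡ suc (s + s) → q ≡ t + t →
                        V s ≡ V t × V (suc s) ≡ V t
image₂-id-copy-at-odd img sf s t refl refl =
  trans (sym (on-odd s)) (trans (SameFactor-letter sf 0 (s≤s z≤n) _ _ (+-identityʳ _) (+-identityʳ _)) (on-even t)) ,
  trans (sym (on-even (suc s)))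
        (trans (SameFactor-letter sf 1 (s≤s (s≤s z≤n)) (suc s + suc s) (suc (t + t)) (solve (s ∷ [])) (solve (t ∷ []))) (on-odd t))
  where open Image₂ img

-- Lengths of x and y when F, H or D begins with x y y x x

BothEven : ℕ → ℕ → Set
BothEven P Q = ∃₂ λ a b → P ≡ a + a × Q ≡ b + b

1≤m+1+n : ∀ m n → 1 ≤ m + suc n
1≤m+1+n m n = ≤-trans (s≤s z≤n) (m≤n+m (suc n) m)

-- Most odd cases put a copy of F 1 F 2 = 11, H 3 H 4 = 11 or D 1 D 2 = 01 at an even position,
-- which image₂-pair rules out.
F-xyyxx-lengths : ∀ P Q → 1 ≤ Q → StartsXYYXX F P Q → (P ≡ 1 × Q ≡ 1) ⊎ BothEven P Q
F-xyyxx-lengths P Q 1≤Q xyyxx with evenOdd P | evenOdd Q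
... | even a      | even b       = inj₂ (a , b , refl , refl)
... | even a      | odd b        = ⊥-elim (image₂-bnot-no-odd-square-at-even F-image a b (yy xyyxx))
... | odd _       | even zero    = ⊥-elim (n≮0 1≤Q)
... | odd zero    | odd zero     = inj₁ (refl , refl)
... | odd zero    | odd (suc b)  =
  ⊥-elim (b1≢b0 (image₂-pair F-image (SameFactor-take 2 (s≤s (s≤s z≤n)) (yy xyyxx)) (b + 2) (solve (b ∷ []))))
... | odd zero    | even (suc b) = ⊥-elim (bnot-≢ (H 0) (image₂-bnot-xyyxx-odd-even F-image 0 b xyyxx))
... | odd (suc a) | _            =
  ⊥-elim (b1≢b0 (image₂-pair F-image (SameFactor-drop 2 (x₂ xyyxx) 1 (s≤s (s≤s (1≤m+1+n a a)))) (a + Q + 2) (solve (a ∷ Q ∷ []))))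

H-xyyxx-lengths : ∀ P Q → 1 ≤ Q → StartsXYYXX H P Q → (P ≡ 1 × Q ≡ 3) ⊎ (P ≡ 3 × Q ≡ 1) ⊎ BothEven P Q
H-xyyxx-lengths P Q 1≤Q xyyxx with evenOdd P | evenOdd Q
... | even a | even b = inj₂ (inj₂ (a , b , refl , refl))
... | even a | odd b  = ⊥-elim (image₂-bnot-no-odd-square-at-even H-image a b (yy xyyxx))
... | odd _  | even zero = ⊥-elim (n≮0 1≤Q)
... | odd zero | odd zero = ⊥-elim (b1≢b0 (sym (SameFactor.at (yy xyyxx) 0 (s≤s z≤n))))
... | odd zero | odd (suc zero) = inj₁ (refl , refl)
... | odd zero | odd (suc (suc b)) =
  ⊥-elim (b1≢b0 (image₂-pair H-image (SameFactor-drop 2 (yy xyyxx) 2 (s≤s (s≤s (s≤s (1≤m+1+n b (suc b)))))) (b + 4) (solve (b ∷ []))))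
... | odd zero | even (suc b) = ⊥-elim (bnot-≢ (D 0) (image₂-bnot-xyyxx-odd-even H-image 0 b xyyxx))
... | odd (suc zero) | odd zero = inj₂ (inj₁ (refl , refl))
... | odd (suc zero) | odd (suc b) =
  ⊥-elim (b1≢b0 (image₂-pair H-image (SameFactor-take 2 (s≤s (s≤s z≤n)) (yy xyyxx)) (b + 3) (solve (b ∷ []))))
... | odd (suc zero) | even (suc b) = ⊥-elim (b1≢b0 (image₂-bnot-xyyxx-odd-even H-image 1 b xyyxx))
... | odd (suc (suc a)) | _ =
  ⊥-elim (b1≢b0 (image₂-pair H-image (SameFactor-drop 2 (x₂ xyyxx) 3 (s≤s (s≤s (s≤s (≤-trans (s≤s (s≤s z≤n)) (m≤n+m (suc (suc a)) a))))))
                             (a + Q + 4) (solve (a ∷ Q ∷ []))))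

D-no-xyyxx-even-one : ∀ a → 1 ≤ a → ¬ StartsXYYXX D (a + a) 1
D-no-xyyxx-even-one 1 _ xyyxx = b1≢b0 (SameFactor.at (x₃ xyyxx) 0 (s≤s z≤n))
D-no-xyyxx-even-one 2 _ xyyxx = b1≢b0 (SameFactor.at (x₂ xyyxx) 0 (s≤s z≤n))
D-no-xyyxx-even-one 3 _ xyyxx = b1≢b0 (SameFactor.at (x₂ xyyxx) 0 (s≤s z≤n))
D-no-xyyxx-even-one 4 _ xyyxx = b1≢b0 (SameFactor.at (x₃ xyyxx) 0 (s≤s z≤n))
-- For a ≥ 5 the word H contains a copy of its first five letters at the odd position 2a + 1.
D-no-xyyxx-even-one a@(suc (suc (suc (suc (suc n))))) _ xyyxx =
  b1≢b0 (image₂-bnot-prefix-at-odd H-image a (SameFactor-take 5 (s≤s (s≤s (s≤s (s≤s (s≤s z≤n))))) H-copy))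
  where
  H-copy : SameFactor H (suc (a + a)) 0 a
  H-copy = SameFactor-descend D-image (x₃ xyyxx) (suc (a + a)) 0 (solve (n ∷ [])) refl

-- The two copies of y start at positions of different parity in D = δ(H); comparing them
-- yields three equal consecutive letters in H.
D-no-xyyxx-even-odd : ∀ a b → ¬ StartsXYYXX D (a + a) (suc (suc b + suc b))
D-no-xyyxx-even-odd a zero xyyxx
  with image₂-id-copy-at-odd D-image (SameFactor-take 2 (s≤s (s≤s z≤n)) (yy xyyxx)) (suc a) a (solve (a ∷ [])) refl
... | e₁ , e₂ = image₂-bnot-no-aaa H-image a (sym e₁) (trans e₁ (sym e₂))
D-no-xyyxx-even-odd a (suc b) xyyxx
  with image₂-id-copy-at-odd D-image (SameFactor-take 2 (s≤s (s≤s z≤n)) (yy xyyxx)) (a + b + 2) a (solve (a ∷ b ∷ [])) refl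
     | image₂-id-copy-at-odd D-image (SameFactor-drop 2 (yy xyyxx) 2 (s≤s (s≤s (s≤s (1≤m+1+n b (suc b))))))
                             (suc (a + b + 2)) (suc a) (solve (a ∷ b ∷ [])) (solve (a ∷ []))
... | e₁ , e₂ | e₃ , e₄ = image₂-bnot-no-aaa H-image (a + b + 2) (trans e₁ (sym e₂)) (trans e₃ (sym e₄))

D-xyyxx-lengths : ∀ P Q → 1 ≤ P → 1 ≤ Q → StartsXYYXX D P Q → BothEven P Q
D-xyyxx-lengths P Q 1≤P 1≤Q xyyxx with evenOdd P | evenOdd Q
... | even a       | even b       = a , b , refl , refl
... | _            | even zero    = ⊥-elim (n≮0 1≤Q)
... | even zero    | _            = ⊥-elim (n≮0 1≤P)
... | even (suc a) | odd zero     = ⊥-elim (D-no-xyyxx-even-one (suc a) (s≤s z≤n) xyyxx)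
... | even a       | odd (suc b)  = ⊥-elim (D-no-xyyxx-even-odd a b xyyxx)
... | odd zero     | odd zero     = ⊥-elim (b1≢b0 (SameFactor.at (yy xyyxx) 0 (s≤s z≤n)))
... | odd zero     | odd (suc b)  =
  ⊥-elim (b1≢b0 (image₂-pair D-image (SameFactor-take 2 (s≤s (s≤s z≤n)) (yy xyyxx)) (b + 2) (solve (b ∷ []))))
... | odd zero     | even c       = ⊥-elim (image₂-bnot-pair-distinct H-image c (begin
  H (c + c)                       ≡⟨ Image₂.on-odd D-image (c + c) ⟨
  D (suc ((c + c) + (c + c)))     ≡⟨ SameFactor-letter (x₂ xyyxx) 0 (s≤s z≤n) (suc ((c + c) + (c + c))) 0 (solve (c ∷ [])) refl ⟩
  D 0                             ≡⟨ SameFactor-letter (x₃ xyyxx) 0 (s≤s z≤n) (suc (c + c) + suc (c + c)) 0 (solve (c ∷ [])) refl ⟨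
  D (suc (c + c) + suc (c + c))   ≡⟨ Image₂.on-even D-image (suc (c + c)) ⟩
  H (suc (c + c))                 ∎))
  where open ≡-Reasoning
... | odd (suc a)  | _            =
  ⊥-elim (b1≢b0 (image₂-pair D-image (SameFactor-drop 2 (x₂ xyyxx) 1 (s≤s (s≤s (1≤m+1+n a a)))) (a + Q + 2) (solve (a ∷ Q ∷ []))))

1≤m+m⇒1≤m : ∀ {m} → 1 ≤ m + m → 1 ≤ m
1≤m+m⇒1≤m {suc m} _ = s≤s z≤n

1≤4m⇒1≤m : ∀ {m} → 1 ≤ (m + m) + (m + m) → 1 ≤ m
1≤4m⇒1≤m = 1≤m+m⇒1≤m ∘ 1≤m+m⇒1≤m

m<4m : ∀ {m} → 1 ≤ m → m < (m + m) + (m + m)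
m<4m {suc m} _ = s≤s (≤-trans (m≤n+m (suc m) m) (m≤m+n (m + suc m) _))

H-xyyxx-quarter : ∀ P Q → 1 ≤ P → 1 ≤ Q → StartsXYYXX H P Q →
                  (P ≡ 1 × Q ≡ 3) ⊎ (P ≡ 3 × Q ≡ 1) ⊎
                  ∃₂ λ c d → P ≡ (c + c) + (c + c) × Q ≡ (d + d) + (d + d) × StartsXYYXX H c d
H-xyyxx-quarter P Q 1≤P 1≤Q xyyxx with H-xyyxx-lengths P Q 1≤Q xyyxx
... | inj₁ lengths        = inj₁ lengths
... | inj₂ (inj₁ lengths) = inj₂ (inj₁ lengths)
... | inj₂ (inj₂ (a , b , refl , refl))
  with D-xyyxx-lengths a b (1≤m+m⇒1≤m 1≤P) (1≤m+m⇒1≤m 1≤Q) (StartsXYYXX-descend H-image a b xyyxx)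
... | c , d , refl , refl =
  inj₂ (inj₂ (c , d , refl , refl , StartsXYYXX-descend D-image c d (StartsXYYXX-descend H-image (c + c) (d + d) xyyxx)))

FourPowerLengths : ℕ → ℕ → Set
FourPowerLengths P Q = ∃[ k ] ((P ≡ 4 ^ k × Q ≡ 3 * 4 ^ k) ⊎ (P ≡ 3 * 4 ^ k × Q ≡ 4 ^ k))

quadruple : ∀ m → (m + m) + (m + m) ≡ 4 * m
quadruple = solve-∀

quadruple-triple : ∀ m → (3 * m + 3 * m) + (3 * m + 3 * m) ≡ 3 * (4 * m)
quadruple-triple = solve-∀

H-xyyxx-classification : ∀ P Q → 1 ≤ P → 1 ≤ Q → StartsXYYXX H P Q → FourPowerLengths P Q
H-xyyxx-classification = <-rec Motive classify
  where
  Motive : ℕ → Set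
  Motive P = ∀ Q → 1 ≤ P → 1 ≤ Q → StartsXYYXX H P Q → FourPowerLengths P Q
  classify : ∀ P → (∀ {P′} → P′ < P → Motive P′) → Motive P
  classify P rec Q 1≤P 1≤Q xyyxx with H-xyyxx-quarter P Q 1≤P 1≤Q xyyxx
  ... | inj₁ (refl , refl)        = 0 , inj₁ (refl , refl)
  ... | inj₂ (inj₁ (refl , refl)) = 0 , inj₂ (refl , refl)
  ... | inj₂ (inj₂ (c , d , refl , refl , xyyxx′))
    with rec (m<4m (1≤4m⇒1≤m 1≤P)) d (1≤4m⇒1≤m 1≤P) (1≤4m⇒1≤m 1≤Q) xyyxx′
  ... | k , inj₁ (refl , refl) = suc k , inj₁ (quadruple (4 ^ k) , quadruple-triple (4 ^ k))
  ... | k , inj₂ (refl , refl) = suc k , inj₂ (quadruple-triple (4 ^ k) , quadruple (4 ^ k))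

double : ∀ m → m + m ≡ 2 * m
double = solve-∀

double-triple : ∀ m → 3 * m + 3 * m ≡ 6 * m
double-triple = solve-∀

F-xyyxx-classification : ∀ P Q → 1 ≤ P → 1 ≤ Q → StartsXYYXX F P Q →
                         (P ≡ 1 × Q ≡ 1) ⊎ ∃[ k ] ((P ≡ 2 * 4 ^ k × Q ≡ 6 * 4 ^ k) ⊎ (P ≡ 6 * 4 ^ k × Q ≡ 2 * 4 ^ k))
F-xyyxx-classification P Q 1≤P 1≤Q xyyxx with F-xyyxx-lengths P Q 1≤Q xyyxx
... | inj₁ lengths = inj₁ lengths
... | inj₂ (a , b , refl , refl)
  with H-xyyxx-classification a b (1≤m+m⇒1≤m 1≤P) (1≤m+m⇒1≤m 1≤Q) (StartsXYYXX-descend F-image a b xyyxx)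
...   | k , inj₁ (refl , refl) = inj₂ (k , inj₁ (double (4 ^ k) , double-triple (4 ^ k)))
...   | k , inj₂ (refl , refl) = inj₂ (k , inj₂ (double-triple (4 ^ k) , double (4 ^ k)))

-- Prefix-preserving substitutions

factor : Word → ℕ → ℕ → List Bit
factor W s zero    = []
factor W s (suc n) = W s ∷ factor W (suc s) n

length-factor : ∀ W s n → length (factor W s n) ≡ n
length-factor W s zero    = refl
length-factor W s (suc n) = cong suc (length-factor W (suc s) n)

factor-+ : ∀ W s m n → factor W s (m + n) ≡ factor W s m ++ factor W (s + m) n
factor-+ W s zero    n = cong (λ t → factor W t n) (sym (+-identityʳ s))
factor-+ W s (suc m) n = cong (W s ∷_) (trans (factor-+ W (suc s) m n) (cong (λ t → factor W (suc s) m ++ factor W t n) (sym (+-suc s m))))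

factor-cong : ∀ {W W′} → (∀ n → W n ≡ W′ n) → ∀ s n → factor W s n ≡ factor W′ s n
factor-cong W≗W′ s zero    = refl
factor-cong W≗W′ s (suc n) = cong₂ _∷_ (W≗W′ s) (factor-cong W≗W′ (suc s) n)

nth-factor : ∀ W s n j d → j < n → nth (factor W s n) j d ≡ W (s + j)
nth-factor W s (suc n) zero    d _         = cong W (sym (+-identityʳ s))
nth-factor W s (suc n) (suc j) d (s≤s j<n) = trans (nth-factor W (suc s) n j d j<n) (cong W (sym (+-suc s j)))

factor-by-nth : ∀ W s (l : List Bit) d → (∀ j → j < length l → nth l j d ≡ W (s + j)) → l ≡ factor W s (length l)
factor-by-nth W s []      d _      = refl
factor-by-nth W s (a ∷ l) d letter = cong₂ _∷_ (trans (letter 0 (s≤s z≤n)) (cong W (+-identityʳ s)))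
  (factor-by-nth W (suc s) l d (λ j j<n → trans (letter (suc j) (s≤s j<n)) (cong W (+-suc s j))))

factor-≡⇒SameFactor : ∀ {W s t n} → factor W s n ≡ factor W t n → SameFactor W s t n
factor-≡⇒SameFactor {W} {s} {t} {n} eq = sameFactor λ j j<n →
  trans (sym (nth-factor W s n j b0 j<n)) (trans (cong (λ l → nth l j b0) eq) (nth-factor W t n j b0 j<n))

applyUpTo-factor : ∀ W s (f : ℕ → Bit) n → (∀ i → f i ≡ W (s + i)) → applyUpTo f n ≡ factor W s n
applyUpTo-factor W s f zero    f≗ = refl
applyUpTo-factor W s f (suc n) f≗ = cong₂ _∷_ (trans (f≗ 0) (cong W (+-identityʳ s)))
  (applyUpTo-factor W (suc s) (f ∘ suc) n (λ i → trans (f≗ (suc i)) (cong W (+-suc s i))))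

map-upTo-factor : ∀ W n → map W (upTo n) ≡ factor W 0 n
map-upTo-factor W n = trans (map-upTo W n) (applyUpTo-factor W 0 W n (λ _ → refl))

factor-++ˡ : ∀ {W s m} A B → A ++ B ≡ factor W s m → A ≡ factor W s (length A)
factor-++ˡ []      B eq = refl
factor-++ˡ {m = suc m} (a ∷ A) B eq with ∷-injective eq
... | a≡ , eq′ = cong₂ _∷_ a≡ (factor-++ˡ A B eq′)

factor-++ʳ : ∀ {W s m} A B → A ++ B ≡ factor W s m → B ≡ factor W (s + length A) (length B)
factor-++ʳ {W} {s} {m} [] B eq = begin
  B                             ≡⟨ eq ⟩
  factor W s m                  ≡⟨ cong (factor W s) (trans (sym (length-factor W s m)) (cong length (sym eq))) ⟩
  factor W s (length B)         ≡⟨ cong (λ t → factor W t (length B)) (+-identityʳ s) ⟨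
  factor W (s + 0) (length B)   ∎
  where open ≡-Reasoning
factor-++ʳ {W} {s} {suc m} (a ∷ A) B eq =
  trans (factor-++ʳ A B (proj₂ (∷-injective eq))) (cong (λ t → factor W t (length B)) (sym (+-suc s (length A))))

nth-++ˡ : ∀ (A B : List Bit) j d → j < length A → nth (A ++ B) j d ≡ nth A j d
nth-++ˡ (a ∷ A) B zero    d _         = refl
nth-++ˡ (a ∷ A) B (suc j) d (s≤s j<n) = nth-++ˡ A B j d j<n

image-++ : ∀ φ A B → image φ (A ++ B) ≡ image φ A ++ image φ B
image-++ φ = concatMap-++ (toList ∘ φ)

toList-∘ˢ : ∀ φ ψ a → toList ((φ ∘ˢ ψ) a) ≡ image φ (toList (ψ a))
toList-∘ˢ φ ψ a = sym (toList->>= φ (ψ a))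

image-∘ˢ : ∀ φ ψ l → image (φ ∘ˢ ψ) l ≡ image φ (image ψ l)
image-∘ˢ φ ψ l = trans (concatMap-cong (toList-∘ˢ φ ψ) l) (MonadProperties.associative l (toList ∘ ψ) (toList ∘ φ))

image-id : ∀ l → image [_] l ≡ l
image-id = concatMap-pure

image-cong : ∀ {φ ψ} → φ ≈ˢ ψ → ∀ l → image φ l ≡ image ψ l
image-cong φ≈ψ = concatMap-cong (cong toList ∘ φ≈ψ)

length-image : ∀ φ l → length l ≤ length (image φ l)
length-image φ []      = z≤n
length-image φ (a ∷ l) with φ a
... | b ∷⁺ bs = s≤s (≤-trans (length-image φ l) (≤-trans (m≤n+m _ (length bs)) (≤-reflexive (sym (length-++ bs)))))

length-image-factor : ∀ φ W n → n ≤ length (image φ (factor W 0 n))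
length-image-factor φ W n = ≤-trans (≤-reflexive (sym (length-factor W 0 n))) (length-image φ (factor W 0 n))

length-image-grows : ∀ ψ → (∀ a → 2 ≤ length (toList (ψ a))) → ∀ w → suc (length (toList w)) ≤ length (image ψ (toList w))
length-image-grows ψ long (a ∷⁺ l) = begin
  2 + length l                                 ≤⟨ +-monoˡ-≤ (length l) (long a) ⟩
  length (toList (ψ a)) + length l             ≤⟨ +-monoʳ-≤ (length (toList (ψ a))) (length-image ψ l) ⟩
  length (toList (ψ a)) + length (image ψ l)   ≡⟨ length-++ (toList (ψ a)) ⟨
  length (toList (ψ a) ++ image ψ l)           ∎
  where open ≤-Reasoning

PreservesPrefixes : Subst → Word → Set
PreservesPrefixes φ W = ∀ n → ∃[ m ] image φ (factor W 0 n) ≡ factor W 0 m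

preserves-id : ∀ W → PreservesPrefixes [_] W
preserves-id W n = n , image-id _

preserves-∘ˢ : ∀ {φ ψ W} → PreservesPrefixes φ W → PreservesPrefixes ψ W → PreservesPrefixes (φ ∘ˢ ψ) W
preserves-∘ˢ {φ} {ψ} {W} φ-pres ψ-pres n with ψ-pres n
... | m , ψ-eq with φ-pres m
...   | k , φ-eq = k , trans (image-∘ˢ φ ψ (factor W 0 n)) (trans (cong (image φ) ψ-eq) φ-eq)

preserves-^ˢ : ∀ {φ W} → PreservesPrefixes φ W → ∀ k → PreservesPrefixes (φ ^ˢ k) W
preserves-^ˢ {W = W} φ-pres zero    = preserves-id W
preserves-^ˢ         φ-pres (suc k) = preserves-∘ˢ φ-pres (preserves-^ˢ φ-pres k)

preserves-≈ˢ : ∀ {φ ψ W} → φ ≈ˢ ψ → PreservesPrefixes ψ W → PreservesPrefixes φ W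
preserves-≈ˢ φ≈ψ ψ-pres n with ψ-pres n
... | m , eq = m , trans (image-cong φ≈ψ (factor _ 0 n)) eq

preserves-≗ : ∀ {φ W W′} → (∀ n → W n ≡ W′ n) → PreservesPrefixes φ W → PreservesPrefixes φ W′
preserves-≗ {φ} W≗W′ pres n with pres n
... | m , eq = m , trans (cong (image φ) (sym (factor-cong W≗W′ 0 n))) (trans eq (factor-cong W≗W′ 0 m))

preserves-from-even : ∀ {φ W} → (∀ n → ∃[ m ] image φ (factor W 0 (n + n)) ≡ factor W 0 m) → PreservesPrefixes φ W
preserves-from-even {φ} {W} even-pres n with even-pres n
... | m , eq = length (image φ (factor W 0 n)) , factor-++ˡ _ (image φ (factor W n n)) (begin
  image φ (factor W 0 n) ++ image φ (factor W n n)   ≡⟨ image-++ φ (factor W 0 n) _ ⟨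
  image φ (factor W 0 n ++ factor W n n)            ≡⟨ cong (image φ) (factor-+ W 0 n n) ⟨
  image φ (factor W 0 (n + n))                      ≡⟨ eq ⟩
  factor W 0 m                                      ∎)
  where open ≡-Reasoning

Fixes : Subst → Word → Set
Fixes φ W = ∀ n → apply φ W n ≡ W n

apply-factor : ∀ φ W n → apply φ W n ≡ nth (image φ (factor W 0 (suc n))) n b0
apply-factor φ W n = cong (λ l → nth (image φ l) n b0) (map-upTo-factor W (suc n))

nth-image-factor-+ : ∀ φ W k r j d → j < length (image φ (factor W 0 k)) →
                     nth (image φ (factor W 0 (k + r))) j d ≡ nth (image φ (factor W 0 k)) j d
nth-image-factor-+ φ W k r j d j<n = begin
  nth (image φ (factor W 0 (k + r))) j d                       ≡⟨ cong (λ l → nth (image φ l) j d) (factor-+ W 0 k r) ⟩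
  nth (image φ (factor W 0 k ++ factor W k r)) j d             ≡⟨ cong (λ l → nth l j d) (image-++ φ (factor W 0 k) _) ⟩
  nth (image φ (factor W 0 k) ++ image φ (factor W k r)) j d   ≡⟨ nth-++ˡ (image φ (factor W 0 k)) (image φ (factor W k r)) j d j<n ⟩
  nth (image φ (factor W 0 k)) j d                             ∎
  where open ≡-Reasoning

preserves⇒fixes : ∀ {φ W} → PreservesPrefixes φ W → Fixes φ W
preserves⇒fixes {φ} {W} pres n with pres (suc n)
... | m , eq = begin
  apply φ W n                               ≡⟨ apply-factor φ W n ⟩
  nth (image φ (factor W 0 (suc n))) n b0   ≡⟨ cong (λ l → nth l n b0) eq ⟩
  nth (factor W 0 m) n b0                   ≡⟨ nth-factor W 0 m n b0 n<m ⟩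
  W n                                       ∎
  where
  open ≡-Reasoning
  n<m : n < m
  n<m = ≤-trans (length-image-factor φ W (suc n)) (≤-reflexive (trans (cong length eq) (length-factor W 0 m)))

fixes⇒preserves : ∀ {φ W} → Fixes φ W → PreservesPrefixes φ W
fixes⇒preserves {φ} {W} fixed k = length (image φ (factor W 0 k)) , factor-by-nth W 0 _ b0 letter
  where
  open ≡-Reasoning
  letter : ∀ j → j < length (image φ (factor W 0 k)) → nth (image φ (factor W 0 k)) j b0 ≡ W j
  letter j j<n = begin
    nth (image φ (factor W 0 k)) j b0             ≡⟨ nth-image-factor-+ φ W k (suc j) j b0 j<n ⟨
    nth (image φ (factor W 0 (k + suc j))) j b0   ≡⟨ cong (λ t → nth (image φ (factor W 0 t)) j b0) (+-comm k (suc j)) ⟩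
    nth (image φ (factor W 0 (suc j + k))) j b0   ≡⟨ nth-image-factor-+ φ W (suc j) k j b0 (length-image-factor φ W (suc j)) ⟩
    nth (image φ (factor W 0 (suc j))) j b0       ≡⟨ apply-factor φ W j ⟨
    apply φ W j                                   ≡⟨ fixed j ⟩
    W j                                           ∎

-- σ, τ and the fixed point u

expand : (Bit → Bit) → List Bit → List Bit
expand g []      = []
expand g (a ∷ l) = a ∷ g a ∷ expand g l

factor-image₂ : ∀ {g V W} → Image₂ g V W → ∀ s n → expand g (factor V s n) ≡ factor W (s + s) (n + n)
factor-image₂ img s zero = refl
factor-image₂ {W = W} img s (suc n) rewrite +-suc n n =
  cong₂ _∷_ (sym (Image₂.on-even img s)) (cong₂ _∷_ (sym (Image₂.on-odd img s))
    (trans (factor-image₂ img (suc s) n) (cong (λ t → factor W t (n + n)) (cong suc (+-suc s s)))))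

-- The hypothesis says ψ ∘ μ = μ ∘ μ ∘ δ.
image-expand-bnot : ∀ ψ → (∀ a → toList (ψ a) ++ toList (ψ (bnot a)) ≡ expand bnot (expand bnot (expand id (a ∷ [])))) →
                    ∀ l → image ψ (expand bnot l) ≡ expand bnot (expand bnot (expand id l))
image-expand-bnot ψ ψμ≡μμδ []      = refl
image-expand-bnot ψ ψμ≡μμδ (a ∷ l) =
  trans (sym (++-assoc (toList (ψ a)) (toList (ψ (bnot a))) _)) (cong₂ _++_ (ψμ≡μμδ a) (image-expand-bnot ψ ψμ≡μμδ l))

preserves-F : ∀ ψ → (∀ a → toList (ψ a) ++ toList (ψ (bnot a)) ≡ expand bnot (expand bnot (expand id (a ∷ [])))) →
              PreservesPrefixes ψ F
preserves-F ψ ψμ≡μμδ = preserves-from-even λ n → (n + n + (n + n)) + (n + n + (n + n)) , (begin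
  image ψ (factor F 0 (n + n))                            ≡⟨ cong (image ψ) (factor-image₂ F-image 0 n) ⟨
  image ψ (expand bnot (factor H 0 n))                    ≡⟨ image-expand-bnot ψ ψμ≡μμδ (factor H 0 n) ⟩
  expand bnot (expand bnot (expand id (factor H 0 n)))    ≡⟨ cong (expand bnot ∘ expand bnot) (factor-image₂ D-image 0 n) ⟩
  expand bnot (expand bnot (factor D 0 (n + n)))          ≡⟨ cong (expand bnot) (factor-image₂ H-image 0 (n + n)) ⟩
  expand bnot (factor H 0 (n + n + (n + n)))              ≡⟨ factor-image₂ F-image 0 (n + n + (n + n)) ⟩
  factor F 0 ((n + n + (n + n)) + (n + n + (n + n)))      ∎)
  where open ≡-Reasoning

σ-preserves-F : PreservesPrefixes σ F
σ-preserves-F = preserves-F σ λ { b0 → refl ; b1 → refl }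

τ-preserves-F : PreservesPrefixes τ F
τ-preserves-F = preserves-F τ λ { b0 → refl ; b1 → refl }

length-σ^ˢ-b0 : ∀ k → suc k ≤ length (toList ((σ ^ˢ k) b0))
length-σ^ˢ-b0 zero    = ≤-refl
length-σ^ˢ-b0 (suc k) = ≤-trans (s≤s (length-σ^ˢ-b0 k))
  (≤-trans (length-image-grows σ (λ { b0 → s≤s (s≤s z≤n) ; b1 → s≤s (s≤s z≤n) }) ((σ ^ˢ k) b0))
           (≤-reflexive (cong length (sym (toList-∘ˢ σ (σ ^ˢ k) b0)))))

u≗F : ∀ n → u n ≡ F n
u≗F n = begin
  nth σⁿ⁺¹0 n b0          ≡⟨ cong (λ l → nth l n b0) (++-identityʳ σⁿ⁺¹0) ⟨
  nth (σⁿ⁺¹0 ++ []) n b0  ≡⟨ cong (λ l → nth l n b0) (proj₂ prefix) ⟩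
  nth (factor F 0 m) n b0 ≡⟨ nth-factor F 0 m n b0 n<m ⟩
  F n                     ∎
  where
  open ≡-Reasoning
  σⁿ⁺¹0 = toList ((σ ^ˢ suc n) b0)
  prefix = preserves-^ˢ σ-preserves-F (suc n) 1
  m = proj₁ prefix
  n<m : n < m
  n<m = ≤-trans (≤-trans (n≤1+n (suc n)) (length-σ^ˢ-b0 (suc n)))
                (≤-reflexive (trans (cong length (sym (++-identityʳ σⁿ⁺¹0))) (trans (cong length (proj₂ prefix)) (length-factor F 0 m))))

stab⇒preserves-F : ∀ {φ} → Stab φ → PreservesPrefixes φ F
stab⇒preserves-F stab = preserves-≗ u≗F (fixes⇒preserves stab)

preserves-F⇒stab : ∀ {φ} → PreservesPrefixes φ F → Stab φ
preserves-F⇒stab pres = preserves⇒fixes (preserves-≗ (sym ∘ u≗F) pres)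

xyyxx-factors : ∀ {W m} x y → x ++ y ++ y ++ x ++ x ++ [] ≡ factor W 0 m →
                x ≡ factor W 0 (length x) × y ≡ factor W (length x) (length y) × StartsXYYXX W (length x) (length y)
xyyxx-factors x y eq =
  x₁ , y₁ , record
    { yy = factor-≡⇒SameFactor (trans (sym y₂) y₁)
    ; x₂ = factor-≡⇒SameFactor (trans (sym x₂′) x₁)
    ; x₃ = factor-≡⇒SameFactor (trans (sym x₃′) x₁)
    }
  where
  x₁ = factor-++ˡ x _ eq
  y₁ = factor-++ˡ y _ (factor-++ʳ x _ eq)
  y₂ = factor-++ˡ y _ (factor-++ʳ y _ (factor-++ʳ x _ eq))
  x₂′ = factor-++ˡ x _ (factor-++ʳ y _ (factor-++ʳ y _ (factor-++ʳ x _ eq)))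
  x₃′ = factor-++ˡ x _ (factor-++ʳ x _ (factor-++ʳ y _ (factor-++ʳ y _ (factor-++ʳ x _ eq))))

module _ {φ : Subst} (pres : PreservesPrefixes φ F) where
  private
    -- F begins with 0 1 1 0 0, which φ maps to x y y x x.
    letters = xyyxx-factors (toList (φ b0)) (toList (φ b1)) (proj₂ (pres 5))

  preserving-b0 : toList (φ b0) ≡ factor F 0 (length (toList (φ b0)))
  preserving-b0 = proj₁ letters

  preserving-b1 : toList (φ b1) ≡ factor F (length (toList (φ b0))) (length (toList (φ b1)))
  preserving-b1 = proj₁ (proj₂ letters)

  preserving-xyyxx : StartsXYYXX F (length (toList (φ b0))) (length (toList (φ b1)))
  preserving-xyyxx = proj₂ (proj₂ letters)

toList-injective : ∀ {v w : List⁺ Bit} → toList v ≡ toList w → v ≡ w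
toList-injective {_ ∷⁺ _} {_ ∷⁺ _} eq with ∷-injective eq
... | refl , refl = refl

preserving-determined-by-lengths : ∀ {φ ψ} → PreservesPrefixes φ F → PreservesPrefixes ψ F →
                                   length (toList (φ b0)) ≡ length (toList (ψ b0)) →
                                   length (toList (φ b1)) ≡ length (toList (ψ b1)) → φ ≈ˢ ψ
preserving-determined-by-lengths φ-pres ψ-pres P≡ Q≡ b0 =
  toList-injective (trans (preserving-b0 φ-pres) (trans (cong (factor F 0) P≡) (sym (preserving-b0 ψ-pres))))
preserving-determined-by-lengths φ-pres ψ-pres P≡ Q≡ b1 =
  toList-injective (trans (preserving-b1 φ-pres) (trans (cong₂ (factor F) P≡ Q≡) (sym (preserving-b1 ψ-pres))))

-- Letter counts

occurrence : Bit → Bit → ℕ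
occurrence b0 b0 = 1
occurrence b1 b1 = 1
occurrence _  _  = 0

count : Bit → List Bit → ℕ
count a []      = 0
count a (b ∷ l) = occurrence a b + count a l

count-++ : ∀ a A B → count a (A ++ B) ≡ count a A + count a B
count-++ a []      B = refl
count-++ a (b ∷ A) B = trans (cong (occurrence a b +_) (count-++ a A B)) (sym (+-assoc (occurrence a b) _ _))

length-count : ∀ l → length l ≡ count b0 l + count b1 l
length-count []       = refl
length-count (b0 ∷ l) = cong suc (length-count l)
length-count (b1 ∷ l) = trans (cong suc (length-count l)) (sym (+-suc (count b0 l) (count b1 l)))

count-image : ∀ ψ a l → count a (image ψ l) ≡ count b0 l * count a (toList (ψ b0)) + count b1 l * count a (toList (ψ b1))
count-image ψ a []      = refl
count-image ψ a (b ∷ l) =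
  trans (count-++ a (toList (ψ b)) (image ψ l)) (trans (cong (count a (toList (ψ b)) +_) (count-image ψ a l)) (regroup b))
  where
  c₀ = count a (toList (ψ b0))
  c₁ = count a (toList (ψ b1))
  regroup : ∀ b → count a (toList (ψ b)) + (count b0 l * c₀ + count b1 l * c₁) ≡ count b0 (b ∷ l) * c₀ + count b1 (b ∷ l) * c₁
  regroup b0 = sym (+-assoc c₀ _ _)
  regroup b1 = x∙yz≈y∙xz c₁ (count b0 l * c₀) _

Balanced : ℕ → List Bit → Set
Balanced c l = ∀ a → count a l ≡ c

balanced-image : ∀ ψ {c₀ c₁ c} l → Balanced c₀ (toList (ψ b0)) → Balanced c₁ (toList (ψ b1)) → Balanced c l →
                 Balanced (c * (c₀ + c₁)) (image ψ l)
balanced-image ψ {c₀} {c₁} {c} l bal₀ bal₁ bal a = begin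
  count a (image ψ l)                                                           ≡⟨ count-image ψ a l ⟩
  count b0 l * count a (toList (ψ b0)) + count b1 l * count a (toList (ψ b1))   ≡⟨ cong₂ _+_ (cong₂ _*_ (bal b0) (bal₀ a)) (cong₂ _*_ (bal b1) (bal₁ a)) ⟩
  c * c₀ + c * c₁                                                               ≡⟨ *-distribˡ-+ c c₀ c₁ ⟨
  c * (c₀ + c₁)                                                                 ∎
  where open ≡-Reasoning

module _ (ψ : Subst) (r : Bit → ℕ) (ψ-balanced : ∀ b → Balanced (r b) (toList (ψ b))) (r₀+r₁≡4 : r b0 + r b1 ≡ 4) where

  power-balanced : ∀ k b → Balanced (r b * 4 ^ k) (toList ((ψ ^ˢ suc k) b))
  power-balanced zero b a = begin
    count a (toList ((ψ ^ˢ 1) b))   ≡⟨ cong (count a) (toList-∘ˢ ψ [_] b) ⟩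
    count a (toList (ψ b) ++ [])    ≡⟨ cong (count a) (++-identityʳ (toList (ψ b))) ⟩
    count a (toList (ψ b))          ≡⟨ ψ-balanced b a ⟩
    r b                             ≡⟨ *-identityʳ (r b) ⟨
    r b * 1                         ∎
    where open ≡-Reasoning
  power-balanced (suc k) b a = begin
    count a (toList ((ψ ^ˢ suc (suc k)) b))       ≡⟨ cong (count a) (toList-∘ˢ ψ (ψ ^ˢ suc k) b) ⟩
    count a (image ψ (toList ((ψ ^ˢ suc k) b)))   ≡⟨ balanced-image ψ (toList ((ψ ^ˢ suc k) b)) (ψ-balanced b0) (ψ-balanced b1) (power-balanced k b) a ⟩
    r b * 4 ^ k * (r b0 + r b1)                   ≡⟨ cong (r b * 4 ^ k *_) r₀+r₁≡4 ⟩
    r b * 4 ^ k * 4                               ≡⟨ times-4 (r b) (4 ^ k) ⟩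
    r b * 4 ^ suc k                               ∎
    where
    open ≡-Reasoning
    times-4 : ∀ x y → x * y * 4 ≡ x * (4 * y)
    times-4 = solve-∀

  length-power : ∀ k b → length (toList ((ψ ^ˢ suc k) b)) ≡ (r b + r b) * 4 ^ k
  length-power k b = trans (length-count (toList ((ψ ^ˢ suc k) b)))
    (trans (cong₂ _+_ (power-balanced k b b0) (power-balanced k b b1)) (sym (*-distribʳ-+ (4 ^ k) (r b) (r b))))

σ-weight τ-weight : Bit → ℕ
σ-weight b0 = 1
σ-weight b1 = 3
τ-weight b0 = 3
τ-weight b1 = 1

σ-balanced : ∀ b → Balanced (σ-weight b) (toList (σ b))
σ-balanced b0 b0 = refl
σ-balanced b0 b1 = refl
σ-balanced b1 b0 = refl
σ-balanced b1 b1 = refl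

τ-balanced : ∀ b → Balanced (τ-weight b) (toList (τ b))
τ-balanced b0 b0 = refl
τ-balanced b0 b1 = refl
τ-balanced b1 b0 = refl
τ-balanced b1 b1 = refl

σ^ˢ-by-lengths : ∀ {φ} → PreservesPrefixes φ F → ∀ k →
                 length (toList (φ b0)) ≡ 2 * 4 ^ k → length (toList (φ b1)) ≡ 6 * 4 ^ k → φ ≈ˢ (σ ^ˢ suc k)
σ^ˢ-by-lengths pres k P≡ Q≡ = preserving-determined-by-lengths pres (preserves-^ˢ σ-preserves-F (suc k))
  (trans P≡ (sym (length-power σ σ-weight σ-balanced refl k b0))) (trans Q≡ (sym (length-power σ σ-weight σ-balanced refl k b1)))

τ^ˢ-by-lengths : ∀ {φ} → PreservesPrefixes φ F → ∀ k →
                 length (toList (φ b0)) ≡ 6 * 4 ^ k → length (toList (φ b1)) ≡ 2 * 4 ^ k → φ ≈ˢ (τ ^ˢ suc k)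
τ^ˢ-by-lengths pres k P≡ Q≡ = preserving-determined-by-lengths pres (preserves-^ˢ τ-preserves-F (suc k))
  (trans P≡ (sym (length-power τ τ-weight τ-balanced refl k b0))) (trans Q≡ (sym (length-power τ τ-weight τ-balanced refl k b1)))

1≤length : ∀ (w : List⁺ Bit) → 1 ≤ length (toList w)
1≤length (_ ∷⁺ _) = s≤s z≤n

preserving-in-family : ∀ {φ} → PreservesPrefixes φ F → InFamily φ
preserving-in-family {φ} pres = from-lengths (F-xyyxx-classification _ _ (1≤length (φ b0)) (1≤length (φ b1)) (preserving-xyyxx pres))
  where
  P = length (toList (φ b0))
  Q = length (toList (φ b1))
  from-lengths : (P ≡ 1 × Q ≡ 1) ⊎ ∃[ k ] ((P ≡ 2 * 4 ^ k × Q ≡ 6 * 4 ^ k) ⊎ (P ≡ 6 * 4 ^ k × Q ≡ 2 * 4 ^ k)) → InFamily φ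
  from-lengths (inj₁ (P≡1 , Q≡1))          = inj₁ (0 , preserving-determined-by-lengths pres (preserves-id F) P≡1 Q≡1)
  from-lengths (inj₂ (k , inj₁ (P≡ , Q≡))) = inj₁ (suc k , σ^ˢ-by-lengths pres k P≡ Q≡)
  from-lengths (inj₂ (k , inj₂ (P≡ , Q≡))) = inj₂ (inj₁ (suc k , τ^ˢ-by-lengths pres k P≡ Q≡))

family-preserving : ∀ {φ} → InFamily φ → PreservesPrefixes φ F
family-preserving (inj₁ (i , φ≈))               = preserves-≈ˢ φ≈ (preserves-^ˢ σ-preserves-F i)
family-preserving (inj₂ (inj₁ (j , φ≈)))        = preserves-≈ˢ φ≈ (preserves-^ˢ τ-preserves-F j)
family-preserving (inj₂ (inj₂ (inj₁ (k , φ≈)))) = preserves-≈ˢ φ≈ (preserves-∘ˢ σ-preserves-F (preserves-^ˢ τ-preserves-F k))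
family-preserving (inj₂ (inj₂ (inj₂ (l , φ≈)))) = preserves-≈ˢ φ≈ (preserves-∘ˢ τ-preserves-F (preserves-^ˢ σ-preserves-F l))

theorem6p1 : (φ : Subst) → (Stab φ → InFamily φ) × (InFamily φ → Stab φ)
theorem6p1 φ = preserving-in-family ∘ stab⇒preserves-F , preserves-F⇒stab ∘ family-preserving
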